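{- For every positive integer $n$, $\mathit{pa}(n)=p_o^*(n)$.
   Context: A partition of a positive integer $n$ is a weakly decreasing sequence of positive integers with sum $n$. An unlimited parity alternating partition is a partition whose different parts alternate in parity: if the distinct part sizes are $d_1>d_2>\cdots>d_r$, then $d_i$ and $d_{i+1}$ have different parities for every $i$ (parts may be repeated). $\mathit{pa}(n)$ is the number of such partitions of $n$. $p_o^*(n)$ is the number of partitions of $n$ in which every part size other than the largest part appears an odd number of times (the largest part may appear any positive number of times). -}

module Defs where

open import Data.Bool using (Bool; true; false; _∧_; not; if_then_else_; T)
open import Data.Nat using (ℕ; zero; suc; _+_; _≡ᵇ_; _≤ᵇ_; _<ᵇ_; _%_)
open import Data.List using (List; []; _∷_)
open import Data.Nat.ListAction using (sum)
open import Data.List.Base using (all)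
open import Data.Product using (Σ)
open import Relation.Nullary.Decidable using (does)

-- A partition is represented by the list of its parts, largest first.

weaklyDecreasing : List ℕ → Bool
weaklyDecreasing []           = true
weaklyDecreasing (x ∷ [])     = true
weaklyDecreasing (x ∷ y ∷ xs) = (y ≤ᵇ x) ∧ weaklyDecreasing (y ∷ xs)

allPositive : List ℕ → Bool
allPositive = all (λ x → 0 <ᵇ x)

isPartitionOf : ℕ → List ℕ → Bool
isPartitionOf n l = weaklyDecreasing l ∧ allPositive l ∧ (sum l ≡ᵇ n)

odd? : ℕ → Bool
odd? k = k % 2 ≡ᵇ 1

sameParity : ℕ → ℕ → Bool
sameParity a b = odd? a ≡ᵇ' odd? b
  where
  _≡ᵇ'_ : Bool → Bool → Bool
  true  ≡ᵇ' b = b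
  false ≡ᵇ' b = not b

distinctParts : List ℕ → List ℕ
distinctParts []           = []
distinctParts (x ∷ [])     = x ∷ []
distinctParts (x ∷ y ∷ xs) =
  if x ≡ᵇ y then distinctParts (y ∷ xs) else x ∷ distinctParts (y ∷ xs)

alternatesInParity : List ℕ → Bool
alternatesInParity []           = true
alternatesInParity (x ∷ [])     = true
alternatesInParity (x ∷ y ∷ xs) = not (sameParity x y) ∧ alternatesInParity (y ∷ xs)

isParityAlternating : List ℕ → Bool
isParityAlternating l = alternatesInParity (distinctParts l)

multiplicity : ℕ → List ℕ → ℕ
multiplicity d []       = 0
multiplicity d (x ∷ xs) = if d ≡ᵇ x then suc (multiplicity d xs) else multiplicity d xs

isPoStar : List ℕ → Bool
isPoStar []          = true
isPoStar l@(m ∷ _)   = all (λ d → if d ≡ᵇ m then true else odd? (multiplicity d l)) l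

-- The set of partitions of n counted by pa(n), and by p_o^*(n).
-- (Bool-valued predicates via T, so membership proofs are unique and the
--  Σ-types have exactly as many elements as the corresponding sets of partitions.)
PA : ℕ → Set
PA n = Σ (List ℕ) (λ l → T (isPartitionOf n l ∧ isParityAlternating l))

PoStar : ℕ → Set
PoStar n = Σ (List ℕ) (λ l → T (isPartitionOf n l ∧ isPoStar l))

module Submission where

open import Defs
open import Data.Nat using (ℕ; _≤_)
open import Function.Bundles using (_↔_)

-- Describe a partition with distinct part sizes d₁ > ⋯ > d_r of multiplicities
-- μ₁, …, μ_r by its list of blocks (gᵢ , mᵢ), where dᵢ - d_{i+1} = gᵢ + 1
-- (with d_{r+1} = 0) and μᵢ = mᵢ + 1.  Every list of pairs of naturals describes
-- exactly one partition, and in these coordinates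
--   * the distinct parts alternate in parity  ⇔  gᵢ is even for every i < r;
--   * every part size but the largest occurs an odd number of times
--                                              ⇔  mᵢ is even for every i > 1.
-- Conjugating the Ferrers diagram turns the horizontal steps of its staircase
-- boundary into vertical ones: on blocks it is  reverse ∘ map swap.  It is an
-- involution, preserves the size, and exchanges the two conditions above; hence
-- it restricts to a bijection between the partitions counted by pa(n) and p_o^*(n).

open import Function.Base using (_∘_; id)
open import Function.Bundles using (mk↔ₛ′; Equivalence)
open import Data.Bool using (Bool; true; false; _∧_; not; if_then_else_; T)
open import Data.Bool.Properties
  using (∧-assoc; ∧-comm; ∧-identityʳ; ∧-idem; T-≡; T-irrelevant)
open import Data.Nat using (zero; suc; _+_; _*_; _∸_; _≡ᵇ_; _≤ᵇ_; _<ᵇ_; _%_; _<_; s≤s)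
open import Data.Nat.Properties
  using (≡ᵇ⇒≡; ≡⇒≡ᵇ; ≤ᵇ⇒≤; ≤⇒≤ᵇ; ≤∧≢⇒<; <⇒≢; >⇒≢; <⇒≤; ≤-refl; ≤-trans; n≤1+n; m≤n+m;
         +-suc; +-comm; +-assoc; +-identityʳ; m∸n+n≡m; m+n∸n≡m)
open import Data.Nat.DivMod using ([m+n]%n≡m%n)
open import Data.Nat.ListAction using (sum)
open import Data.Nat.Tactic.RingSolver using (solve-∀)
open import Data.List using (List; []; _∷_; [_]; _++_; _∷ʳ_; replicate; map; reverse)
open import Data.List.Base using (all)
open import Data.List.Properties using (unfold-reverse; reverse-map; reverse-involutive; map-∘; map-id)
open import Data.List.Relation.Unary.All using (All; []; _∷_) renaming (map to All-map)
open import Data.List.Relation.Unary.All.Properties using (++⁺; replicate⁺)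
open import Data.Product using (Σ; _,_; _×_; proj₁; proj₂; swap)
open import Data.Empty using (⊥-elim)
open import Relation.Binary.PropositionalEquality
  using (_≡_; _≢_; refl; sym; trans; cong; cong₂; subst; module ≡-Reasoning)
open ≡-Reasoning

∧-split : ∀ {a b} → a ∧ b ≡ true → a ≡ true × b ≡ true
∧-split {true} {true} _ = refl , refl

≡ᵇ-refl : ∀ n → (n ≡ᵇ n) ≡ true
≡ᵇ-refl n = Equivalence.to T-≡ (≡⇒≡ᵇ n n refl)

≡ᵇ-true : ∀ {m n} → (m ≡ᵇ n) ≡ true → m ≡ n
≡ᵇ-true {m} {n} eq = ≡ᵇ⇒≡ m n (Equivalence.from T-≡ eq)

≡ᵇ-false : ∀ {m n} → (m ≡ᵇ n) ≡ false → m ≢ n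
≡ᵇ-false {m} eq refl with trans (sym eq) (≡ᵇ-refl m)
... | ()

≤⇒≤ᵇ≡true : ∀ {m n} → m ≤ n → (m ≤ᵇ n) ≡ true
≤⇒≤ᵇ≡true m≤n = Equivalence.to T-≡ (≤⇒≤ᵇ m≤n)

≢⇒≡ᵇ-false : ∀ {m n} → m ≢ n → (m ≡ᵇ n) ≡ false
≢⇒≡ᵇ-false {m} {n} m≢n with m ≡ᵇ n in eq
... | false = refl
... | true  = ⊥-elim (m≢n (≡ᵇ-true eq))

all-++ : ∀ {A : Set} (f : A → Bool) xs ys → all f (xs ++ ys) ≡ all f xs ∧ all f ys
all-++ f []       ys = refl
all-++ f (x ∷ xs) ys = trans (cong (f x ∧_) (all-++ f xs ys)) (sym (∧-assoc (f x) _ _))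

all-replicate : ∀ {A : Set} (f : A → Bool) k x → all f (replicate (suc k) x) ≡ f x
all-replicate f zero    x = ∧-identityʳ (f x)
all-replicate f (suc k) x = trans (cong (f x ∧_) (all-replicate f k x)) (∧-idem (f x))

all-run : ∀ {A : Set} (f : A → Bool) k x ys → all f (replicate (suc k) x ++ ys) ≡ f x ∧ all f ys
all-run f k x ys = trans (all-++ f (replicate (suc k) x) ys) (cong (_∧ all f ys) (all-replicate f k x))

all-cong-All : ∀ {A : Set} {P : A → Set} (f g : A → Bool) {xs} →
               (∀ {x} → P x → f x ≡ g x) → All P xs → all f xs ≡ all g xs
all-cong-All f g f≗g []         = refl
all-cong-All f g f≗g (px ∷ pxs) = cong₂ _∧_ (f≗g px) (all-cong-All f g f≗g pxs)

even? : ℕ → Bool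
even? n = not (odd? n)

odd?-+2 : ∀ n → odd? (suc (suc n)) ≡ odd? n
odd?-+2 n = cong (_≡ᵇ 1) (trans (cong (_% 2) (+-comm 2 n)) ([m+n]%n≡m%n n 2))

odd?-suc : ∀ n → odd? (suc n) ≡ even? n
odd?-suc zero          = refl
odd?-suc (suc zero)    = refl
odd?-suc (suc (suc n)) = trans (odd?-+2 (suc n)) (trans (odd?-suc n) (cong not (sym (odd?-+2 n))))

-- sameParity, in terms of odd? (Defs hides its Boolean equality in a where-block)
_⇔ᵇ_ : Bool → Bool → Bool
true  ⇔ᵇ b = b
false ⇔ᵇ b = not b

sameParity-odd? : ∀ a b → sameParity a b ≡ (odd? a ⇔ᵇ odd? b)
sameParity-odd? a b with odd? a
... | true  = refl
... | false = refl

differentParity-gap : ∀ g k → not (sameParity (suc (g + k)) k) ≡ even? g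
differentParity-gap g k = trans (cong not (sameParity-odd? (suc (g + k)) k)) (by-gap g)
  where
  not-⇔ᵇ-not : ∀ b → not (not b ⇔ᵇ b) ≡ true
  not-⇔ᵇ-not true  = refl
  not-⇔ᵇ-not false = refl

  not-⇔ᵇ-self : ∀ b → not (b ⇔ᵇ b) ≡ false
  not-⇔ᵇ-self true  = refl
  not-⇔ᵇ-self false = refl

  by-gap : ∀ g → not (odd? (suc (g + k)) ⇔ᵇ odd? k) ≡ even? g
  by-gap zero          = trans (cong (λ b → not (b ⇔ᵇ odd? k)) (odd?-suc k)) (not-⇔ᵇ-not (odd? k))
  by-gap (suc zero)    = trans (cong (λ b → not (b ⇔ᵇ odd? k)) (odd?-+2 k)) (not-⇔ᵇ-self (odd? k))
  by-gap (suc (suc g)) = trans (cong (λ b → not (b ⇔ᵇ odd? k)) (odd?-+2 (suc (g + k))))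
                               (trans (by-gap g) (cong not (sym (odd?-+2 g))))

-- A block (g , m) stands for m + 1 equal parts exceeding the next smaller part
-- size (0 after the last block) by g + 1.
Block : Set
Block = ℕ × ℕ

top : List Block → ℕ
top []             = 0
top ((g , m) ∷ bs) = suc (g + top bs)

parts : List Block → List ℕ
parts []             = []
parts ((g , m) ∷ bs) = replicate (suc m) (suc (g + top bs)) ++ parts bs

sizes : List Block → List ℕ
sizes []       = []
sizes (b ∷ bs) = top (b ∷ bs) ∷ sizes bs

addCopy : List Block → List Block
addCopy []             = []
addCopy ((g , m) ∷ bs) = (g , suc m) ∷ bs

blocks : List ℕ → List Block
blocks []           = []
blocks (x ∷ [])     = (x ∸ 1 , 0) ∷ []
blocks (x ∷ y ∷ xs) =
  if x ≡ᵇ y then addCopy (blocks (y ∷ xs)) else (x ∸ suc y , 0) ∷ blocks (y ∷ xs)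

parts-≤-top : ∀ bs → All (_≤ top bs) (parts bs)
parts-≤-top []             = []
parts-≤-top ((g , m) ∷ bs) =
  ++⁺ (replicate⁺ (suc m) ≤-refl)
      (All-map (λ d≤ → ≤-trans d≤ (≤-trans (m≤n+m _ g) (n≤1+n _))) (parts-≤-top bs))

parts-below : ∀ g bs → All (_< suc (g + top bs)) (parts bs)
parts-below g bs = All-map (λ d≤ → s≤s (≤-trans d≤ (m≤n+m _ g))) (parts-≤-top bs)

IsPartition : List ℕ → Set
IsPartition l = weaklyDecreasing l ≡ true × allPositive l ≡ true

weaklyDecreasing-run : ∀ m h t → All (_< h) t → weaklyDecreasing t ≡ true →
                       weaklyDecreasing (replicate (suc m) h ++ t) ≡ true
weaklyDecreasing-run zero    h []      _         _   = refl
weaklyDecreasing-run zero    h (y ∷ t) (y<h ∷ _) dec = cong₂ _∧_ (≤⇒≤ᵇ≡true (<⇒≤ y<h)) dec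
weaklyDecreasing-run (suc m) h t       below     dec =
  cong₂ _∧_ (≤⇒≤ᵇ≡true (≤-refl {h})) (weaklyDecreasing-run m h t below dec)

parts-isPartition : ∀ bs → IsPartition (parts bs)
parts-isPartition []             = refl , refl
parts-isPartition ((g , m) ∷ bs) =
  weaklyDecreasing-run m _ (parts bs) (parts-below g bs) (proj₁ (parts-isPartition bs)) ,
  trans (all-run (0 <ᵇ_) m (suc (g + top bs)) (parts bs)) (proj₂ (parts-isPartition bs))

size : List Block → ℕ
size []             = 0
size ((g , m) ∷ bs) = suc m * suc (g + top bs) + size bs

sum-parts : ∀ bs → sum (parts bs) ≡ size bs
sum-parts []             = refl
sum-parts ((g , m) ∷ bs) = trans (sum-run (suc m)) (cong (suc m * suc (g + top bs) +_) (sum-parts bs))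
  where
  sum-run : ∀ k → sum (replicate k (suc (g + top bs)) ++ parts bs) ≡ k * suc (g + top bs) + sum (parts bs)
  sum-run zero    = refl
  sum-run (suc k) = trans (cong (suc (g + top bs) +_) (sum-run k)) (sym (+-assoc (suc (g + top bs)) _ _))

isPartitionOf-parts : ∀ n bs → isPartitionOf n (parts bs) ≡ (size bs ≡ᵇ n)
isPartitionOf-parts n bs
  rewrite proj₁ (parts-isPartition bs) | proj₂ (parts-isPartition bs) | sum-parts bs = refl

parts-addCopy : ∀ bs {z zs} → parts bs ≡ z ∷ zs →
                parts (addCopy bs) ≡ top bs ∷ parts bs × top (addCopy bs) ≡ top bs
parts-addCopy (b ∷ bs) _ = refl , refl

parts-blocks-top : ∀ x xs → IsPartition (x ∷ xs) →
                   parts (blocks (x ∷ xs)) ≡ x ∷ xs × top (blocks (x ∷ xs)) ≡ x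
parts-blocks-top zero    [] (_ , ())
parts-blocks-top (suc x) [] _ = cong [_] x+0≡x , x+0≡x
  where
  x+0≡x : suc (x + 0) ≡ suc x
  x+0≡x = cong suc (+-identityʳ x)
parts-blocks-top x (y ∷ xs) (dec , pos) with ∧-split {y ≤ᵇ x} dec | ∧-split {0 <ᵇ x} pos
... | y≤ᵇx , dec′ | _ , pos′ with parts-blocks-top y xs (dec′ , pos′) | x ≡ᵇ y in x≟y
... | parts≡ , top≡ | true =
  let x≡y          = ≡ᵇ-true x≟y
      added , top′ = parts-addCopy (blocks (y ∷ xs)) parts≡
  in  trans added (cong₂ _∷_ (trans top≡ (sym x≡y)) parts≡) , trans top′ (trans top≡ (sym x≡y))
... | parts≡ , top≡ | false = cong₂ _∷_ top-x parts≡ , top-x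
  where
  y<x : suc y ≤ x
  y<x = ≤∧≢⇒< (≤ᵇ⇒≤ y x (Equivalence.from T-≡ y≤ᵇx)) (λ y≡x → ≡ᵇ-false x≟y (sym y≡x))
  top-x : suc (x ∸ suc y + top (blocks (y ∷ xs))) ≡ x
  top-x = begin
    suc (x ∸ suc y + top (blocks (y ∷ xs))) ≡⟨ cong (λ t → suc (x ∸ suc y + t)) top≡ ⟩
    suc (x ∸ suc y + y)                     ≡⟨ sym (+-suc (x ∸ suc y) y) ⟩
    x ∸ suc y + suc y                       ≡⟨ m∸n+n≡m y<x ⟩
    x                                       ∎

parts-blocks : ∀ l → IsPartition l → parts (blocks l) ≡ l
parts-blocks []       _ = refl
parts-blocks (x ∷ xs) v = proj₁ (parts-blocks-top x xs v)

blocks-parts-∷ : ∀ g m bs → blocks (parts bs) ≡ bs → blocks (parts ((g , m) ∷ bs)) ≡ (g , m) ∷ bs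
blocks-parts-∷ g (suc m) bs ih rewrite ≡ᵇ-refl (suc (g + top bs)) = cong addCopy (blocks-parts-∷ g m bs ih)
blocks-parts-∷ g zero    []   _  = cong (λ d → (d , 0) ∷ []) (+-identityʳ g)
blocks-parts-∷ g zero    ((g′ , m′) ∷ bs) ih
  rewrite ≢⇒≡ᵇ-false (>⇒≢ (s≤s (m≤n+m (suc (g′ + top bs)) g))) =
    cong₂ (λ d rest → (d , 0) ∷ rest) (m+n∸n≡m g (suc (g′ + top bs))) ih

blocks-parts : ∀ bs → blocks (parts bs) ≡ bs
blocks-parts []             = refl
blocks-parts ((g , m) ∷ bs) = blocks-parts-∷ g m bs (blocks-parts bs)

evenGaps : List Block → Bool
evenGaps []                 = true
evenGaps (b ∷ [])           = true
evenGaps ((g , m) ∷ b ∷ bs) = even? g ∧ evenGaps (b ∷ bs)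

-- every block has an odd number of copies
oddCopies : List Block → Bool
oddCopies = all (even? ∘ proj₂)

tailOddCopies : List Block → Bool
tailOddCopies []       = true
tailOddCopies (b ∷ bs) = oddCopies bs

distinctParts-run : ∀ m h t → All (_< h) t →
                    distinctParts (replicate (suc m) h ++ t) ≡ h ∷ distinctParts t
distinctParts-run zero    h []      _         = refl
distinctParts-run zero    h (y ∷ t) (y<h ∷ _) rewrite ≢⇒≡ᵇ-false (>⇒≢ y<h) = refl
distinctParts-run (suc m) h t       below     rewrite ≡ᵇ-refl h = distinctParts-run m h t below

distinctParts-parts : ∀ bs → distinctParts (parts bs) ≡ sizes bs
distinctParts-parts []             = refl
distinctParts-parts ((g , m) ∷ bs) =
  trans (distinctParts-run m _ (parts bs) (parts-below g bs))
        (cong (suc (g + top bs) ∷_) (distinctParts-parts bs))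

-- Consecutive block sizes differ by gap + 1, so they alternate in parity
-- exactly when all gaps but the last are even.
isParityAlternating-parts : ∀ bs → isParityAlternating (parts bs) ≡ evenGaps bs
isParityAlternating-parts bs = trans (cong alternatesInParity (distinctParts-parts bs)) (alternating bs)
  where
  alternating : ∀ bs → alternatesInParity (sizes bs) ≡ evenGaps bs
  alternating []                 = refl
  alternating (b ∷ [])           = refl
  alternating ((g , m) ∷ c ∷ cs) = cong₂ _∧_ (differentParity-gap g (top (c ∷ cs))) (alternating (c ∷ cs))

multiplicity-run-below : ∀ d h k t → d < h → multiplicity d (replicate k h ++ t) ≡ multiplicity d t
multiplicity-run-below d h zero    t d<h = refl
multiplicity-run-below d h (suc k) t d<h
  rewrite ≢⇒≡ᵇ-false (<⇒≢ d<h) = multiplicity-run-below d h k t d<h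

multiplicity-run-top : ∀ h k t → All (_< h) t → multiplicity h (replicate k h ++ t) ≡ k
multiplicity-run-top h zero    []        _          = refl
multiplicity-run-top h zero    (y ∷ t)   (y<h ∷ ys)
  rewrite ≢⇒≡ᵇ-false (>⇒≢ y<h) = multiplicity-run-top h zero t ys
multiplicity-run-top h (suc k) t         below
  rewrite ≡ᵇ-refl h = cong suc (multiplicity-run-top h k t below)

allOddMultiplicity : List ℕ → Bool
allOddMultiplicity l = all (λ d → odd? (multiplicity d l)) l

allOddMultiplicity-parts : ∀ bs → allOddMultiplicity (parts bs) ≡ oddCopies bs
allOddMultiplicity-parts []             = refl
allOddMultiplicity-parts ((g , m) ∷ bs) = begin
  all φ (replicate (suc m) h ++ parts bs)   ≡⟨ all-run φ m h (parts bs) ⟩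
  φ h ∧ all φ (parts bs)                    ≡⟨ cong₂ _∧_ φ-top φ-below ⟩
  even? m ∧ allOddMultiplicity (parts bs)   ≡⟨ cong (even? m ∧_) (allOddMultiplicity-parts bs) ⟩
  even? m ∧ oddCopies bs                    ∎
  where
  h : ℕ
  h = suc (g + top bs)
  φ : ℕ → Bool
  φ d = odd? (multiplicity d (replicate (suc m) h ++ parts bs))
  φ-top : φ h ≡ even? m
  φ-top = trans (cong odd? (multiplicity-run-top h (suc m) (parts bs) (parts-below g bs))) (odd?-suc m)
  φ-below : all φ (parts bs) ≡ allOddMultiplicity (parts bs)
  φ-below = all-cong-All φ _ (λ {d} d<h → cong odd? (multiplicity-run-below d h (suc m) (parts bs) d<h))
                         (parts-below g bs)

-- the largest part is exempt, which exempts the first block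
isPoStar-parts : ∀ bs → isPoStar (parts bs) ≡ tailOddCopies bs
isPoStar-parts []             = refl
isPoStar-parts ((g , m) ∷ bs) = begin
  all ψ (replicate (suc m) h ++ parts bs)   ≡⟨ all-run ψ m h (parts bs) ⟩
  ψ h ∧ all ψ (parts bs)                    ≡⟨ cong (_∧ all ψ (parts bs)) ψ-top ⟩
  all ψ (parts bs)                          ≡⟨ all-cong-All ψ _ ψ-below (parts-below g bs) ⟩
  allOddMultiplicity (parts bs)             ≡⟨ allOddMultiplicity-parts bs ⟩
  oddCopies bs                              ∎
  where
  h : ℕ
  h = suc (g + top bs)
  φ ψ : ℕ → Bool
  φ d = odd? (multiplicity d (replicate (suc m) h ++ parts bs))
  ψ d = if d ≡ᵇ h then true else φ d
  ψ-top : ψ h ≡ true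
  ψ-top rewrite ≡ᵇ-refl h = refl
  ψ-below : ∀ {d} → d < h → ψ d ≡ odd? (multiplicity d (parts bs))
  ψ-below {d} d<h =
    trans (cong (λ b → if b then true else φ d) (≢⇒≡ᵇ-false (<⇒≢ d<h)))
          (cong odd? (multiplicity-run-below d h (suc m) (parts bs) d<h))

-- Transposing the Ferrers diagram traverses its staircase boundary backwards,
-- with horizontal and vertical steps exchanged.
conj : List Block → List Block
conj bs = reverse (map swap bs)

conj-∷ : ∀ b bs → conj (b ∷ bs) ≡ conj bs ∷ʳ swap b
conj-∷ b bs = unfold-reverse (swap b) (map swap bs)

conj-involutive : ∀ bs → conj (conj bs) ≡ bs
conj-involutive bs = begin
  reverse (map swap (reverse (map swap bs))) ≡⟨ cong reverse (reverse-map swap (map swap bs)) ⟩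
  reverse (reverse (map swap (map swap bs))) ≡⟨ reverse-involutive _ ⟩
  map swap (map swap bs)                     ≡⟨ map-∘ bs ⟨
  map id bs                                  ≡⟨ map-id bs ⟩
  bs                                         ∎

oddCopies-∷ʳ : ∀ bs b → oddCopies (bs ∷ʳ b) ≡ oddCopies bs ∧ even? (proj₂ b)
oddCopies-∷ʳ bs b = trans (all-++ (even? ∘ proj₂) bs [ b ]) (cong (oddCopies bs ∧_) (∧-identityʳ _))

tailOddCopies-∷ʳ : ∀ bs b c →
                   tailOddCopies ((bs ∷ʳ b) ∷ʳ c) ≡ tailOddCopies (bs ∷ʳ b) ∧ even? (proj₂ c)
tailOddCopies-∷ʳ []       b c = oddCopies-∷ʳ [] c
tailOddCopies-∷ʳ (a ∷ bs) b c = oddCopies-∷ʳ (bs ∷ʳ b) c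

-- Conjugation turns the gaps (but the last) into the multiplicities (but the first).
tailOddCopies-conj : ∀ bs → tailOddCopies (conj bs) ≡ evenGaps bs
tailOddCopies-conj []                 = refl
tailOddCopies-conj (b ∷ [])           = refl
tailOddCopies-conj ((g , m) ∷ c ∷ cs) = begin
  tailOddCopies (conj ((g , m) ∷ c ∷ cs))
    ≡⟨ cong tailOddCopies (conj-∷ (g , m) (c ∷ cs)) ⟩
  tailOddCopies (conj (c ∷ cs) ∷ʳ (m , g))
    ≡⟨ cong (λ q → tailOddCopies (q ∷ʳ (m , g))) (conj-∷ c cs) ⟩
  tailOddCopies ((conj cs ∷ʳ swap c) ∷ʳ (m , g))
    ≡⟨ tailOddCopies-∷ʳ (conj cs) (swap c) (m , g) ⟩
  tailOddCopies (conj cs ∷ʳ swap c) ∧ even? g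
    ≡⟨ cong (λ q → tailOddCopies q ∧ even? g) (conj-∷ c cs) ⟨
  tailOddCopies (conj (c ∷ cs)) ∧ even? g
    ≡⟨ cong (_∧ even? g) (tailOddCopies-conj (c ∷ cs)) ⟩
  evenGaps (c ∷ cs) ∧ even? g
    ≡⟨ ∧-comm (evenGaps (c ∷ cs)) (even? g) ⟩
  even? g ∧ evenGaps (c ∷ cs)
    ∎

count : List Block → ℕ
count []             = 0
count ((g , m) ∷ bs) = suc m + count bs

-- Appending a block (a , b) at the bottom raises every part by a + 1 and adds
-- b + 1 parts of size a + 1.
top-∷ʳ : ∀ bs a b → top (bs ∷ʳ (a , b)) ≡ top bs + suc a
top-∷ʳ []             a b = cong suc (+-identityʳ a)
top-∷ʳ ((g , m) ∷ bs) a b = cong suc (trans (cong (g +_) (top-∷ʳ bs a b)) (sym (+-assoc g _ _)))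

count-∷ʳ : ∀ bs a b → count (bs ∷ʳ (a , b)) ≡ count bs + suc b
count-∷ʳ []             a b = cong suc (+-identityʳ b)
count-∷ʳ ((g , m) ∷ bs) a b = cong suc (trans (cong (m +_) (count-∷ʳ bs a b)) (sym (+-assoc m _ _)))

size-∷ʳ : ∀ bs a b → size (bs ∷ʳ (a , b)) ≡ size bs + suc a * count bs + suc b * suc a
size-∷ʳ []             a b = single a b
  where
  single : ∀ a b → suc b * suc (a + 0) + 0 ≡ 0 + suc a * 0 + suc b * suc a
  single = solve-∀
size-∷ʳ ((g , m) ∷ bs) a b
  rewrite top-∷ʳ bs a b | size-∷ʳ bs a b = step m g (top bs) a (size bs) (count bs) b
  where
  step : ∀ m g t a s c b →
         suc m * suc (g + (t + suc a)) + (s + suc a * c + suc b * suc a)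
           ≡ (suc m * suc (g + t) + s) + suc a * (suc m + c) + suc b * suc a
  step = solve-∀

count-conj : ∀ bs → count (conj bs) ≡ top bs
count-conj []             = refl
count-conj ((g , m) ∷ bs) = begin
  count (conj ((g , m) ∷ bs))   ≡⟨ cong count (conj-∷ (g , m) bs) ⟩
  count (conj bs ∷ʳ (m , g))    ≡⟨ count-∷ʳ (conj bs) m g ⟩
  count (conj bs) + suc g       ≡⟨ cong (_+ suc g) (count-conj bs) ⟩
  top bs + suc g                ≡⟨ +-comm (top bs) (suc g) ⟩
  suc (g + top bs)              ∎

size-conj : ∀ bs → size (conj bs) ≡ size bs
size-conj []             = refl
size-conj ((g , m) ∷ bs) = begin
  size (conj ((g , m) ∷ bs))
    ≡⟨ cong size (conj-∷ (g , m) bs) ⟩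
  size (conj bs ∷ʳ (m , g))
    ≡⟨ size-∷ʳ (conj bs) m g ⟩
  size (conj bs) + suc m * count (conj bs) + suc g * suc m
    ≡⟨ cong₂ (λ s c → s + suc m * c + suc g * suc m) (size-conj bs) (count-conj bs) ⟩
  size bs + suc m * top bs + suc g * suc m
    ≡⟨ regroup m g (top bs) (size bs) ⟩
  suc m * suc (g + top bs) + size bs
    ∎
  where
  regroup : ∀ m g t s → s + suc m * t + suc g * suc m ≡ suc m * suc (g + t) + s
  regroup = solve-∀

conjugate : List ℕ → List ℕ
conjugate l = parts (conj (blocks l))

conjugate-isPartition : ∀ l → IsPartition (conjugate l)
conjugate-isPartition l = parts-isPartition (conj (blocks l))

conjugate-involutive : ∀ l → IsPartition l → conjugate (conjugate l) ≡ l
conjugate-involutive l v = begin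
  parts (conj (blocks (parts (conj (blocks l)))))
    ≡⟨ cong (parts ∘ conj) (blocks-parts (conj (blocks l))) ⟩
  parts (conj (conj (blocks l)))
    ≡⟨ cong parts (conj-involutive (blocks l)) ⟩
  parts (blocks l)
    ≡⟨ parts-blocks l v ⟩
  l ∎

isPartitionOf-conjugate : ∀ n l → IsPartition l → isPartitionOf n (conjugate l) ≡ isPartitionOf n l
isPartitionOf-conjugate n l v = begin
  isPartitionOf n (parts (conj (blocks l))) ≡⟨ isPartitionOf-parts n (conj (blocks l)) ⟩
  (size (conj (blocks l)) ≡ᵇ n)             ≡⟨ cong (_≡ᵇ n) (size-conj (blocks l)) ⟩
  (size (blocks l) ≡ᵇ n)                    ≡⟨ isPartitionOf-parts n (blocks l) ⟨
  isPartitionOf n (parts (blocks l))        ≡⟨ cong (isPartitionOf n) (parts-blocks l v) ⟩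
  isPartitionOf n l                         ∎

isPoStar-conjugate : ∀ l → IsPartition l → isPoStar (conjugate l) ≡ isParityAlternating l
isPoStar-conjugate l v = begin
  isPoStar (parts (conj (blocks l)))     ≡⟨ isPoStar-parts (conj (blocks l)) ⟩
  tailOddCopies (conj (blocks l))        ≡⟨ tailOddCopies-conj (blocks l) ⟩
  evenGaps (blocks l)                    ≡⟨ isParityAlternating-parts (blocks l) ⟨
  isParityAlternating (parts (blocks l)) ≡⟨ cong isParityAlternating (parts-blocks l v) ⟩
  isParityAlternating l                  ∎

-- the converse, from involutivity
isParityAlternating-conjugate : ∀ l → IsPartition l → isParityAlternating (conjugate l) ≡ isPoStar l
isParityAlternating-conjugate l v = begin
  isParityAlternating (conjugate l)       ≡⟨ isPoStar-conjugate (conjugate l) (conjugate-isPartition l) ⟨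
  isPoStar (conjugate (conjugate l))      ≡⟨ cong isPoStar (conjugate-involutive l v) ⟩
  isPoStar l                              ∎

isPartitionOf⇒IsPartition : ∀ n l {b} → T (isPartitionOf n l ∧ b) → IsPartition l
isPartitionOf⇒IsPartition n l t with weaklyDecreasing l | allPositive l
... | true  | true  = refl , refl
... | true  | false = ⊥-elim t
... | false | _     = ⊥-elim t

exchange↔ : ∀ {A : Set} (P Q : A → Bool) (f : A → A) →
            (∀ a → T (P a) → T (Q (f a))) → (∀ a → T (Q a) → T (P (f a))) →
            (∀ a → T (P a) → f (f a) ≡ a) → (∀ a → T (Q a) → f (f a) ≡ a) →
            Σ A (T ∘ P) ↔ Σ A (T ∘ Q)
exchange↔ {A} P Q f P⇒Q Q⇒P f²-P f²-Q = mk↔ₛ′ to from to∘from from∘to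
  where
  ≡-selected : ∀ (R : A → Bool) {a a′} (a≡a′ : a ≡ a′) (r : T (R a)) (r′ : T (R a′)) →
               _≡_ {A = Σ A (T ∘ R)} (a , r) (a′ , r′)
  ≡-selected R refl r r′ = cong (_ ,_) (T-irrelevant r r′)

  to : Σ A (T ∘ P) → Σ A (T ∘ Q)
  to (a , p) = f a , P⇒Q a p
  from : Σ A (T ∘ Q) → Σ A (T ∘ P)
  from (a , q) = f a , Q⇒P a q
  to∘from : ∀ y → to (from y) ≡ y
  to∘from (a , q) = ≡-selected Q (f²-Q a q) _ q
  from∘to : ∀ x → from (to x) ≡ x
  from∘to (a , p) = ≡-selected P (f²-P a p) _ p

-- pa(n) = p_o^*(n): conjugation exchanges the two kinds of partitions of n.
theorem3p1 : (n : ℕ) → 1 ≤ n → PA n ↔ PoStar n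
theorem3p1 n _ = exchange↔ alternating poStar conjugate
                           alternating⇒poStar poStar⇒alternating
                           (λ l t → conjugate-involutive l (shape l t))
                           (λ l t → conjugate-involutive l (shape l t))
  where
  alternating poStar : List ℕ → Bool
  alternating l = isPartitionOf n l ∧ isParityAlternating l
  poStar      l = isPartitionOf n l ∧ isPoStar l

  shape : ∀ l {b} → T (isPartitionOf n l ∧ b) → IsPartition l
  shape = isPartitionOf⇒IsPartition n

  alternating⇒poStar : ∀ l → T (alternating l) → T (poStar (conjugate l))
  alternating⇒poStar l t =
    subst T (sym (cong₂ _∧_ (isPartitionOf-conjugate n l (shape l t))
                            (isPoStar-conjugate l (shape l t)))) t

  poStar⇒alternating : ∀ l → T (poStar l) → T (alternating (conjugate l))
  poStar⇒alternating l t =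
    subst T (sym (cong₂ _∧_ (isPartitionOf-conjugate n l (shape l t))
                            (isParityAlternating-conjugate l (shape l t)))) t
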